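{- Let $a,b,c,d\ge1$ be integers and let $n\ge abcd$. Let $T$ be a tree and let $T_1,\dots,T_n$ be subtrees of $T$, each with maximum degree at most $d$. Then either there are $a$ of $T_1,\dots,T_n$ that are pairwise vertex-disjoint, or there is an edge of $T$ that belongs to $b$ of $T_1,\dots,T_n$, or there is a vertex $v\in V(T)$ and $c$ of $T_1,\dots,T_n$ that pairwise intersect exactly in $\{v\}$. -}

module Defs where

open import Data.Nat using (ℕ; zero; suc; _≤_; _*_)
open import Data.Fin using (Fin; zero; suc; inject₁)
open import Data.Bool using (Bool; true; false; _∧_; if_then_else_)
open import Data.List using (List; map; allFin)
open import Data.Nat.ListAction using (sum)
open import Data.Product using (Σ; ∃; ∃-syntax; _×_; _,_)
open import Data.Sum using (_⊎_)
open import Function.Definitions using (Injective)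
open import Relation.Binary.PropositionalEquality using (_≡_; _≢_)
open import Relation.Nullary using (¬_)

record Graph (m : ℕ) : Set where
  field
    adj       : Fin m → Fin m → Bool
    adj-sym   : ∀ u v → adj u v ≡ true → adj v u ≡ true
    adj-irrefl : ∀ v → adj v v ≡ false
open Graph public

VSet : ℕ → Set
VSet m = Fin m → Bool

_∈ᵥ_ : ∀ {m} → Fin m → VSet m → Set
v ∈ᵥ S = S v ≡ true

record WalkIn {m : ℕ} (G : Graph m) (S : VSet m) (u v : Fin m) : Set where
  field
    len    : ℕ
    vtx    : Fin (suc len) → Fin m
    start  : vtx zero ≡ u
    end    : vtx (Data.Fin.fromℕ len) ≡ v
    inside : ∀ i → vtx i ∈ᵥ S
    steps  : ∀ (i : Fin len) → adj G (vtx (inject₁ i)) (vtx (suc i)) ≡ true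

full : ∀ {m} → VSet m
full _ = true

ConnectedIn : ∀ {m} → Graph m → VSet m → Set
ConnectedIn G S = ∀ u v → u ∈ᵥ S → v ∈ᵥ S → WalkIn G S u v

record Cycle {m : ℕ} (G : Graph m) : Set where
  field
    len   : ℕ          -- number of vertices is len + 3
    vtx   : Fin (suc (suc (suc len))) → Fin m
    inj   : Injective _≡_ _≡_ vtx
    steps : ∀ (i : Fin (suc (suc len))) → adj G (vtx (inject₁ i)) (vtx (suc i)) ≡ true
    close : adj G (vtx (Data.Fin.fromℕ (suc (suc len)))) (vtx zero) ≡ true

-- A (finite) tree: nonempty, connected, acyclic.
IsTree : ∀ {m} → Graph m → Set
IsTree {m} G = Fin m × ConnectedIn G full × ¬ Cycle G

-- A subtree of T, given by its vertex set (a connected subgraph of a tree is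
-- the induced subgraph on its vertex set): nonempty and connected inside S.
IsSubtree : ∀ {m} → Graph m → VSet m → Set
IsSubtree {m} G S = (∃[ v ] v ∈ᵥ S) × ConnectedIn G S

degIn : ∀ {m} → Graph m → VSet m → Fin m → ℕ
degIn {m} G S v = sum (map (λ u → if S u ∧ adj G v u then 1 else 0) (allFin m))

MaxDegAtMost : ∀ {m} → Graph m → VSet m → ℕ → Set
MaxDegAtMost G S d = ∀ v → v ∈ᵥ S → degIn G S v ≤ d

HasDisjoint : ∀ {m n} → (Fin n → VSet m) → ℕ → Set
HasDisjoint {m} {n} Ts a =
  Σ (Fin a → Fin n) λ f → Injective _≡_ _≡_ f ×
    (∀ i j → i ≢ j → ∀ (w : Fin m) → ¬ (w ∈ᵥ Ts (f i) × w ∈ᵥ Ts (f j)))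

HasHeavyEdge : ∀ {m n} → Graph m → (Fin n → VSet m) → ℕ → Set
HasHeavyEdge {m} {n} G Ts b =
  Σ (Fin m) λ u → Σ (Fin m) λ v → adj G u v ≡ true ×
    Σ (Fin b → Fin n) λ g → Injective _≡_ _≡_ g ×
      (∀ k → u ∈ᵥ Ts (g k) × v ∈ᵥ Ts (g k))

HasStar : ∀ {m n} → (Fin n → VSet m) → ℕ → Set
HasStar {m} {n} Ts c =
  Σ (Fin m) λ v → Σ (Fin c → Fin n) λ h → Injective _≡_ _≡_ h ×
    (∀ k → v ∈ᵥ Ts (h k)) ×
    (∀ i j → i ≢ j → ∀ (w : Fin m) → w ∈ᵥ Ts (h i) → w ∈ᵥ Ts (h j) → w ≡ v)

-- Call r an anchor of T_i in a subfamily A if every member of A meeting T_i contains r.  Every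
-- nonempty subfamily has an anchored member: if some T_j ∈ A meets T_i but misses r, move to the
-- first vertex r' of T_j on a path from r towards T_i ∩ T_j; the branches of T at r' into T_j
-- are strictly inside a branch at r into T_i, so this descent terminates.
-- Now fix an anchored T_i with anchor r.  If some edge at r lies in b subtrees we are done.
-- Otherwise a subtree through r shares an edge at r with at most d(b − 1) others, so if b·c·d
-- subtrees contain r, c of them pairwise share no edge at r, and subtrees of a tree through r
-- sharing no edge at r meet exactly in r.  Otherwise discarding the fewer than b·c·d subtrees
-- through r leaves (a − 1)·b·c·d subtrees, none meeting T_i, and induction on a applies.

module Submission where

open import Defs
open import Data.Bool using (Bool; true; false; _∧_; _∨_; not; if_then_else_)
open import Data.Bool.Properties
  using (∧-conicalˡ; ∧-conicalʳ; ∨-conicalʳ; not-injective) renaming (_≟_ to _≟ᵇ_)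
open import Data.Empty using (⊥-elim)
open import Data.Fin using (Fin; zero; suc; inject₁; fromℕ)
open import Data.Fin.Properties using (_≟_; any?; injective⇒≤)
open import Data.List using (map; allFin; tabulate)
open import Data.List.Properties using (map-tabulate)
open import Data.Nat using (ℕ; zero; suc; _+_; _*_; _≤_; _<_; _≤?_; z≤n; s≤s; s≤s⁻¹; pred)
import Data.Nat.ListAction as List
open import Data.Nat.Properties hiding (_≟_)
open import Data.Nat.Tactic.RingSolver using (solve-∀)
open import Algebra.Properties.Semiring.Sum +-*-semiring
  using (sum; sum-syntax; sum-cong-≗; ∑-distrib-+; ∑-comm; *-distribˡ-sum; *-distribʳ-sum)
open import Data.Product using (Σ; ∃; _×_; _,_; proj₁; proj₂)
open import Data.Sum using (_⊎_; inj₁; inj₂)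
import Data.Sum as Sum
open import Data.Unit using (⊤; tt)
open import Function using (_$_; _∘_)
open import Function.Definitions using (Injective)
open import Relation.Binary.PropositionalEquality
open import Relation.Nullary using (¬_; Dec; yes; no; does; contradiction)
open import Relation.Nullary.Decidable using (_×-dec_; ¬?; map′; dec-true; dec-false)

does-true⇒ : ∀ {a} {A : Set a} (A? : Dec A) → does A? ≡ true → A
does-true⇒ (yes a) _ = a

does-false⇒ : ∀ {a} {A : Set a} (A? : Dec A) → does A? ≡ false → ¬ A
does-false⇒ (no ¬a) _ = ¬a

∧-intro : ∀ {a b} → a ≡ true → b ≡ true → a ∧ b ≡ true
∧-intro refl refl = refl

∈ᵥ⇒≢ : ∀ {m} {S : VSet m} {u v} → u ∈ᵥ S → S v ≡ false → u ≢ v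
∈ᵥ⇒≢ u∈S v∉S refl = contradiction (trans (sym u∈S) v∉S) λ ()

-- Counting

𝟙 : Bool → ℕ
𝟙 b = if b then 1 else 0

count : ∀ {n} → (Fin n → Bool) → ℕ
count {n} A = ∑[ i < n ] 𝟙 (A i)

List-sum-allFin : ∀ {n} (f : Fin n → ℕ) → List.sum (map f (allFin n)) ≡ sum f
List-sum-allFin {n} f = trans (cong List.sum (map-tabulate (λ i → i) f)) (sum-tabulate f)
  where
  sum-tabulate : ∀ {n} (f : Fin n → ℕ) → List.sum (tabulate f) ≡ sum f
  sum-tabulate {zero} f = refl
  sum-tabulate {suc n} f = cong (f zero +_) (sum-tabulate (λ i → f (suc i)))

sum-mono-≤ : ∀ {n} {f g : Fin n → ℕ} → (∀ i → f i ≤ g i) → sum f ≤ sum g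
sum-mono-≤ {zero} f≤g = z≤n
sum-mono-≤ {suc n} f≤g = +-mono-≤ (f≤g zero) (sum-mono-≤ (λ i → f≤g (suc i)))

sum-mono-< : ∀ {n} {f g : Fin n → ℕ} → (∀ i → f i ≤ g i) → ∀ j → f j < g j → sum f < sum g
sum-mono-< f≤g zero fj<gj = +-mono-<-≤ fj<gj (sum-mono-≤ (λ i → f≤g (suc i)))
sum-mono-< f≤g (suc j) fj<gj = +-mono-≤-< (f≤g zero) (sum-mono-< (λ i → f≤g (suc i)) j fj<gj)

term≤sum : ∀ {n} (f : Fin n → ℕ) i → f i ≤ sum f
term≤sum f zero = m≤m+n _ _
term≤sum f (suc i) = ≤-trans (term≤sum (λ j → f (suc j)) i) (m≤n+m _ _)

count≤size : ∀ {n} (A : Fin n → Bool) → count A ≤ n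
count≤size {zero} A = z≤n
count≤size {suc n} A with A zero
... | true = s≤s (count≤size (λ i → A (suc i)))
... | false = m≤n⇒m≤1+n (count≤size (λ i → A (suc i)))

count-full : ∀ {n} → count {n} (λ _ → true) ≡ n
count-full {zero} = refl
count-full {suc n} = cong suc (count-full {n})

count-none : ∀ {n} → count {n} (λ _ → false) ≡ 0
count-none {zero} = refl
count-none {suc n} = count-none {n}

count-singleton : ∀ {n} (j : Fin n) → count (λ i → does (i ≟ j)) ≤ 1
count-singleton {suc n} zero = ≤-reflexive (cong suc (count-none {n}))
count-singleton {suc n} (suc j) = count-singleton j

count-nonempty : ∀ {n} (A : Fin n → Bool) → 1 ≤ count A → ∃ λ i → A i ≡ true
count-nonempty {suc n} A 1≤count with A zero in eq
... | true = zero , eq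
... | false = let (i , Ai) = count-nonempty (λ i → A (suc i)) 1≤count in suc i , Ai

count-split : ∀ {n} (A B : Fin n → Bool) →
              count A ≡ count (λ i → A i ∧ not (B i)) + count (λ i → A i ∧ B i)
count-split A B =
  trans (sum-cong-≗ (λ i → split (A i) (B i)))
        (∑-distrib-+ (λ i → 𝟙 (A i ∧ not (B i))) (λ i → 𝟙 (A i ∧ B i)))
  where
  split : ∀ a b → 𝟙 a ≡ 𝟙 (a ∧ not b) + 𝟙 (a ∧ b)
  split true true = refl
  split true false = refl
  split false b = refl

count-∖ : ∀ {n k D} (A B : Fin n → Bool) → D + k ≤ count A → count (λ i → A i ∧ B i) ≤ D →
          k ≤ count (λ i → A i ∧ not (B i))
count-∖ {k = k} {D} A B D+k≤|A| |A∩B|≤D = +-cancelˡ-≤ D k |A∖B| (begin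
  D + k                                 ≤⟨ D+k≤|A| ⟩
  count A                               ≡⟨ count-split A B ⟩
  |A∖B| + count (λ i → A i ∧ B i)       ≤⟨ +-monoʳ-≤ |A∖B| |A∩B|≤D ⟩
  |A∖B| + D                             ≡⟨ +-comm |A∖B| D ⟩
  D + |A∖B|                             ∎)
  where
  open ≤-Reasoning
  |A∖B| = count (λ i → A i ∧ not (B i))

count-∪ : ∀ {n} (A B : Fin n → Bool) → count (λ i → A i ∨ B i) ≤ count A + count B
count-∪ A B =
  ≤-trans (sum-mono-≤ (λ i → 𝟙-∨ (A i) (B i))) (≤-reflexive (∑-distrib-+ (λ i → 𝟙 (A i)) (λ i → 𝟙 (B i))))
  where
  𝟙-∨ : ∀ a b → 𝟙 (a ∨ b) ≤ 𝟙 a + 𝟙 b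
  𝟙-∨ true b = s≤s z≤n
  𝟙-∨ false b = ≤-refl

𝟙-mono : ∀ {a b} → (a ≡ true → b ≡ true) → 𝟙 a ≤ 𝟙 b
𝟙-mono {true} a⇒b rewrite a⇒b refl = ≤-refl
𝟙-mono {false} a⇒b = z≤n

count-mono : ∀ {n} {A B : Fin n → Bool} → (∀ i → A i ≡ true → B i ≡ true) → count A ≤ count B
count-mono A⊆B = sum-mono-≤ (λ i → 𝟙-mono (A⊆B i))

count-mono-< : ∀ {n} {A B : Fin n → Bool} → (∀ i → A i ≡ true → B i ≡ true) →
               ∀ j → A j ≡ false → B j ≡ true → count A < count B
count-mono-< A⊆B j Aj Bj =
  sum-mono-< (λ i → 𝟙-mono (A⊆B i)) j (subst₂ (λ a b → 𝟙 a < 𝟙 b) (sym Aj) (sym Bj) ≤-refl)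

union-bound : ∀ {k n} (B : Fin k → Bool) (C : Fin k → Fin n → Bool) (U : Fin n → Bool) →
              (∀ j → U j ≡ true → ∃ λ x → B x ≡ true × C x j ≡ true) →
              count U ≤ ∑[ x < k ] (𝟙 (B x) * count (C x))
union-bound {k} {n} B C U covered = begin
  count U                                       ≤⟨ sum-mono-≤ covered-at ⟩
  ∑[ j < n ] ∑[ x < k ] (𝟙 (B x) * 𝟙 (C x j))     ≡⟨ ∑-comm (λ j x → 𝟙 (B x) * 𝟙 (C x j)) ⟩
  ∑[ x < k ] ∑[ j < n ] (𝟙 (B x) * 𝟙 (C x j))
    ≡⟨ sum-cong-≗ (λ x → sym (*-distribˡ-sum (𝟙 (B x)) (λ j → 𝟙 (C x j)))) ⟩
  ∑[ x < k ] (𝟙 (B x) * count (C x))              ∎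
  where
  open ≤-Reasoning
  covered-at : ∀ j → 𝟙 (U j) ≤ ∑[ x < k ] (𝟙 (B x) * 𝟙 (C x j))
  covered-at j with U j in Uj
  ... | false = z≤n
  ... | true with covered j Uj
  ... | x , Bx , Cxj = ≤-trans (≤-reflexive (sym (cong₂ (λ b c → 𝟙 b * 𝟙 c) Bx Cxj))) (term≤sum _ x)

Independent : ∀ {n k} → (Fin n → Fin n → Bool) → (Fin k → Fin n) → Set
Independent R h = ∀ i i' → i ≢ i' → R (h i) (h i') ≡ false ⊎ R (h i') (h i) ≡ false

independent⇒injective : ∀ {n k} (R : Fin n → Fin n → Bool) → (∀ j → R j j ≡ true) →
                        {h : Fin k → Fin n} → Independent R h → Injective _≡_ _≡_ h
independent⇒injective R R-refl {h} indep {i} {i'} hi≡hi' with i ≟ i'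
... | yes i≡i' = i≡i'
... | no i≢i' with indep i i' i≢i'
... | inj₁ R≡false =
  contradiction (trans (sym (R-refl (h i))) (trans (cong (R (h i)) hi≡hi') R≡false)) λ ()
... | inj₂ R≡false =
  contradiction (trans (sym (R-refl (h i'))) (trans (cong (R (h i')) (sym hi≡hi')) R≡false)) λ ()

-- Greedily: pick any j ∈ A, discard the at most D elements in conflict with j, and recurse.
select-independent : ∀ {n} k {D} → 1 ≤ D → (A : Fin n → Bool) (R : Fin n → Fin n → Bool) →
                     (∀ j → R j j ≡ true) → (∀ j → A j ≡ true → count (R j) ≤ D) → k * D ≤ count A →
                     Σ (Fin k → Fin n) λ h → (∀ i → A (h i) ≡ true) × Independent R h
select-independent zero _ A R _ _ _ = (λ ()) , (λ ()) , (λ ())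
select-independent {n} (suc k) {D} 1≤D A R R-refl conflicts≤D k+1D≤|A| = h , h∈A , h-independent
  where
  j∈A : ∃ λ j → A j ≡ true
  j∈A = count-nonempty A (≤-trans 1≤D (≤-trans (m≤m+n D (k * D)) k+1D≤|A|))
  j = proj₁ j∈A
  A' : Fin n → Bool
  A' i = A i ∧ not (R j i)
  |A∩Rj|≤D : count (λ i → A i ∧ R j i) ≤ D
  |A∩Rj|≤D = ≤-trans (count-mono (λ i → ∧-conicalʳ (A i) _)) (conflicts≤D j (proj₂ j∈A))
  rest = select-independent k 1≤D A' R R-refl (λ i A'i → conflicts≤D i (∧-conicalˡ _ _ A'i))
           (count-∖ A (R j) k+1D≤|A| |A∩Rj|≤D)
  h' = proj₁ rest
  h'∉Rj : ∀ i → R j (h' i) ≡ false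
  h'∉Rj i = not-injective (∧-conicalʳ _ _ (proj₁ (proj₂ rest) i))
  h : Fin (suc k) → Fin n
  h zero = j
  h (suc i) = h' i
  h∈A : ∀ i → A (h i) ≡ true
  h∈A zero = proj₂ j∈A
  h∈A (suc i) = ∧-conicalˡ _ _ (proj₁ (proj₂ rest) i)
  h-independent : Independent R h
  h-independent zero zero 0≢0 = contradiction refl 0≢0
  h-independent zero (suc i') _ = inj₁ (h'∉Rj i')
  h-independent (suc i) zero _ = inj₂ (h'∉Rj i)
  h-independent (suc i) (suc i') i≢i' = proj₂ (proj₂ rest) i i' (λ i≡i' → i≢i' (cong suc i≡i'))

select-distinct : ∀ {n} k (A : Fin n → Bool) → k ≤ count A →
                  Σ (Fin k → Fin n) λ h → Injective _≡_ _≡_ h × (∀ i → A (h i) ≡ true)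
select-distinct {n} k A k≤|A| =
  let (h , h∈A , independent) = select-independent k ≤-refl A Same Same-refl (λ j _ → count-singleton j)
                                  (subst (_≤ count A) (sym (*-identityʳ k)) k≤|A|)
  in h , independent⇒injective Same Same-refl independent , h∈A
  where
  Same : Fin n → Fin n → Bool
  Same j j' = does (j' ≟ j)
  Same-refl : ∀ j → Same j j ≡ true
  Same-refl j = dec-true (j ≟ j) refl

-- Paths in a graph

module Paths {m} (G : Graph m) where

  data Path (P : Fin m → Set) : Fin m → Fin m → Set where
    here : ∀ {u} → P u → Path P u u
    step : ∀ {u v w} → P u → adj G u v ≡ true → Path P v w → Path P u w

  module _ {P : Fin m → Set} where

    infixr 5 _++_

    first∈ : ∀ {u w} → Path P u w → P u
    first∈ (here p) = p
    first∈ (step p _ _) = p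

    last∈ : ∀ {u w} → Path P u w → P w
    last∈ (here p) = p
    last∈ (step _ _ q) = last∈ q

    _++_ : ∀ {u v w} → Path P u v → Path P v w → Path P u w
    here _ ++ q = q
    step p e q ++ q' = step p e (q ++ q')

    reverse : ∀ {u w} → Path P u w → Path P w u
    reverse (here p) = here p
    reverse (step p e q) = reverse q ++ step (first∈ q) (adj-sym G _ _ e) (here p)

    length : ∀ {u w} → Path P u w → ℕ
    length (here _) = 0
    length (step _ _ q) = suc (length q)

    vertex : ∀ {u w} (q : Path P u w) → Fin (suc (length q)) → Fin m
    vertex (here {u} _) zero = u
    vertex (step {u} _ _ _) zero = u
    vertex (step _ _ q) (suc i) = vertex q i

    vertex-∈ : ∀ {u w} (q : Path P u w) i → P (vertex q i)
    vertex-∈ (here p) zero = p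
    vertex-∈ (step p _ _) zero = p
    vertex-∈ (step _ _ q) (suc i) = vertex-∈ q i

    vertex-first : ∀ {u w} (q : Path P u w) → vertex q zero ≡ u
    vertex-first (here _) = refl
    vertex-first (step _ _ _) = refl

    vertex-last : ∀ {u w} (q : Path P u w) → vertex q (fromℕ (length q)) ≡ w
    vertex-last (here _) = refl
    vertex-last (step _ _ q) = vertex-last q

    vertex-adj : ∀ {u w} (q : Path P u w) (i : Fin (length q)) →
                 adj G (vertex q (inject₁ i)) (vertex q (suc i)) ≡ true
    vertex-adj (step _ e q) zero = subst (λ v → adj G _ v ≡ true) (sym (vertex-first q)) e
    vertex-adj (step _ _ q) (suc i) = vertex-adj q i

    Simple : ∀ {u w} → Path P u w → Set
    Simple (here _) = ⊤
    Simple (step {u} _ _ q) = (∀ i → vertex q i ≢ u) × Simple q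

    simple⇒vertex-injective : ∀ {u w} (q : Path P u w) → Simple q → Injective _≡_ _≡_ (vertex q)
    simple⇒vertex-injective (here _) _ {zero} {zero} _ = refl
    simple⇒vertex-injective (step _ _ _) _ {zero} {zero} _ = refl
    simple⇒vertex-injective (step _ _ _) (u∉q , _) {zero} {suc j} u≡qj = contradiction (sym u≡qj) (u∉q j)
    simple⇒vertex-injective (step _ _ _) (u∉q , _) {suc i} {zero} qi≡u = contradiction qi≡u (u∉q i)
    simple⇒vertex-injective (step _ _ q) (_ , simple) {suc i} {suc j} qi≡qj =
      cong suc (simple⇒vertex-injective q simple qi≡qj)

    simple-length : ∀ {u w} (q : Path P u w) → Simple q → length q < m
    simple-length q simple = injective⇒≤ (simple⇒vertex-injective q simple)

    simple-suffix : ∀ {v w} (q : Path P v w) → Simple q → ∀ i → Σ (Path P (vertex q i) w) Simple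
    simple-suffix (here p) _ zero = here p , tt
    simple-suffix (step p e q) simple zero = step p e q , simple
    simple-suffix (step _ _ q) (_ , simple) (suc i) = simple-suffix q simple i

    simplify : ∀ {u w} → Path P u w → Σ (Path P u w) Simple
    simplify (here p) = here p , tt
    simplify (step {u} p e q) with simplify q
    ... | q' , simple with any? (λ i → vertex q' i ≟ u)
    ... | yes (i , qi≡u) = subst (λ v → Σ (Path P v _) Simple) qi≡u (simple-suffix q' simple i)
    ... | no u∉q' = step p e q' , (λ i qi≡u → u∉q' (i , qi≡u)) , simple

  weaken : ∀ {P Q : Fin m → Set} → (∀ {v} → P v → Q v) → ∀ {u w} → Path P u w → Path Q u w
  weaken P⇒Q (here p) = here (P⇒Q p)
  weaken P⇒Q (step p e q) = step (P⇒Q p) e (weaken P⇒Q q)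

  fromWalk : ∀ {S u v} → WalkIn G S u v → Path (_∈ᵥ S) u v
  fromWalk {S} walk =
    subst₂ (Path _) (WalkIn.start walk) (WalkIn.end walk)
      (along (WalkIn.len walk) (WalkIn.vtx walk) (WalkIn.inside walk) (WalkIn.steps walk))
    where
    along : ∀ l (f : Fin (suc l) → Fin m) → (∀ i → f i ∈ᵥ S) →
            (∀ (i : Fin l) → adj G (f (inject₁ i)) (f (suc i)) ≡ true) →
            Path (_∈ᵥ S) (f zero) (f (fromℕ l))
    along zero f f∈S _ = here (f∈S zero)
    along (suc l) f f∈S f-adj =
      step (f∈S zero) (f-adj zero) (along l (λ i → f (suc i)) (λ i → f∈S (suc i)) (λ i → f-adj (suc i)))

  reachable-within? : ∀ {P} → (∀ v → Dec (P v)) → ∀ L u w → Dec (Σ (Path P u w) λ q → length q ≤ L)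
  reachable-within? P? L u w with P? u
  ... | no ¬Pu = no λ (q , _) → ¬Pu (first∈ q)
  ... | yes Pu with u ≟ w
  ... | yes refl = yes (here Pu , z≤n)
  reachable-within? P? zero u w | yes Pu | no u≢w =
    no λ { (here _ , _) → u≢w refl ; (step _ _ _ , ()) }
  reachable-within? P? (suc L) u w | yes Pu | no u≢w
    with any? (λ v → (adj G u v ≟ᵇ true) ×-dec reachable-within? P? L v w)
  ... | yes (v , e , q , len≤L) = yes (step Pu e q , s≤s len≤L)
  ... | no ¬next =
    no λ { (here _ , _) → u≢w refl ; (step _ e q , s≤s len≤L) → ¬next (_ , e , q , len≤L) }

  reachable? : ∀ {P} → (∀ v → Dec (P v)) → ∀ u w → Dec (Path P u w)
  reachable? P? u w = map′ proj₁ shortcut (reachable-within? P? m u w)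
    where
    shortcut : ∀ {P} → Path P u w → Σ (Path P u w) λ q → length q ≤ m
    shortcut q = let (q' , simple) = simplify q in q' , <⇒≤ (simple-length q' simple)

  Avoid : Fin m → Fin m → Set
  Avoid z v = v ≢ z

  -- The component of G − z containing x (empty when x = z).
  Branch : Fin m → Fin m → VSet m
  Branch z x v = does (reachable? (λ u → ¬? (u ≟ z)) x v)

  branch-sound : ∀ {z x v} → v ∈ᵥ Branch z x → Path (Avoid z) x v
  branch-sound {z} {x} {v} = does-true⇒ (reachable? (λ u → ¬? (u ≟ z)) x v)

  branch-complete : ∀ {z x v} → Path (Avoid z) x v → v ∈ᵥ Branch z x
  branch-complete {z} {x} {v} = dec-true (reachable? (λ u → ¬? (u ≟ z)) x v)

  branch-excludes-root : ∀ z x → Branch z x z ≡ false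
  branch-excludes-root z x = dec-false (reachable? (λ u → ¬? (u ≟ z)) x z) (λ q → last∈ q refl)

  avoid-or-reach : ∀ {P} r {u v} → Path P u v → Path (Avoid r) u v ⊎ Path P u r
  avoid-or-reach r {v = v} (here p) with v ≟ r
  ... | yes refl = inj₂ (here p)
  ... | no v≢r = inj₁ (here v≢r)
  avoid-or-reach r (step {u} p e q) with u ≟ r
  ... | yes refl = inj₂ (here p)
  ... | no u≢r with avoid-or-reach r q
  ... | inj₁ q' = inj₁ (step u≢r e q')
  ... | inj₂ q' = inj₂ (step p e q')

  last-exit : ∀ {P r w} → Path P r w → w ≢ r → ∃ λ x → adj G r x ≡ true × P x × Path (Avoid r) x w
  last-exit {P} {r} {w} q w≢r with exits q
    where
    exits : ∀ {u} → Path P u w →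
            Path (Avoid r) u w ⊎ (∃ λ x → adj G r x ≡ true × P x × Path (Avoid r) x w)
    exits (here _) = inj₁ (here w≢r)
    exits (step {u} p e q) with exits q
    ... | inj₂ exit = inj₂ exit
    ... | inj₁ q' with u ≟ r
    ... | yes refl = inj₂ (_ , e , first∈ q , q')
    ... | no u≢r = inj₁ (step u≢r e q')
  ... | inj₁ q' = contradiction refl (first∈ q')
  ... | inj₂ exit = exit

  first-entry : ∀ {P} (S : VSet m) {u₀ u w} → ¬ u₀ ∈ᵥ S → adj G u₀ u ≡ true → Path P u w → w ∈ᵥ S →
                Σ (Fin m) λ p → Σ (Fin m) λ s → adj G p s ≡ true × s ∈ᵥ S ×
                  Path (λ v → ¬ v ∈ᵥ S) u₀ p × Path P u s
  first-entry S {u₀} {u} u₀∉S e q w∈S with S u in u∈S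
  ... | true = u₀ , u , e , u∈S , here u₀∉S , here (first∈ q)
  first-entry S u₀∉S e (here _) w∈S | false = contradiction (trans (sym u∈S) w∈S) λ ()
  first-entry S u₀∉S e (step p e' q) w∈S | false
    with first-entry S (λ u∈S' → contradiction (trans (sym u∈S) u∈S') λ ()) e' q w∈S
  ... | p' , s , e'' , s∈S , outside , inside =
    p' , s , e'' , s∈S , step u₀∉S e outside , step p e' inside

-- Acyclic graphs

module _ {m} {G : Graph m} (acyclic : ¬ Cycle G) where

  open Paths G

  neighbours-separated : ∀ {z x y} → x ≢ y → adj G z x ≡ true → adj G z y ≡ true → ¬ Path (Avoid z) x y
  neighbours-separated {z} x≢y zx zy q with simplify q
  ... | here _ , _ = x≢y refl
  ... | step p e q' , simple = acyclic cycle
    where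
    path = step p e q'
    cycleVertex : Fin (suc (suc (suc (length q')))) → Fin m
    cycleVertex zero = z
    cycleVertex (suc i) = vertex path i
    injective : Injective _≡_ _≡_ cycleVertex
    injective {zero} {zero} _ = refl
    injective {zero} {suc j} z≡qj = contradiction (sym z≡qj) (vertex-∈ path j)
    injective {suc i} {zero} qi≡z = contradiction qi≡z (vertex-∈ path i)
    injective {suc i} {suc j} qi≡qj = cong suc (simple⇒vertex-injective path simple qi≡qj)
    steps : ∀ i → adj G (cycleVertex (inject₁ i)) (cycleVertex (suc i)) ≡ true
    steps zero = zx
    steps (suc i) = vertex-adj path i
    cycle : Cycle G
    cycle = record
      { len = length q' ; vtx = cycleVertex ; inj = injective ; steps = steps
      ; close = subst (λ t → adj G t z ≡ true) (sym (vertex-last path)) (adj-sym G _ _ zy) }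

-- Families of subtrees of a tree

module _ {m n} {T : Graph m} (acyclic : ¬ Cycle T) (Ts : Fin n → VSet m)
         (connected : ∀ i → ConnectedIn T (Ts i)) where

  open Paths T

  Meets : Fin n → Fin n → Set
  Meets i j = ∃ λ w → w ∈ᵥ Ts i × w ∈ᵥ Ts j

  meets? : ∀ i j → Dec (Meets i j)
  meets? i j = any? (λ w → (Ts i w ≟ᵇ true) ×-dec (Ts j w ≟ᵇ true))

  Anchor : (Fin n → Bool) → Fin n → Fin m → Set
  Anchor A i r = A i ≡ true × r ∈ᵥ Ts i × (∀ j → A j ≡ true → Meets i j → r ∈ᵥ Ts j)

  record Descent (i j : Fin n) (r : Fin m) : Set where
    field
      r'      : Fin m
      r'∈Tj   : r' ∈ᵥ Ts j
      x       : Fin m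
      r~x     : adj T r x ≡ true
      x∈Ti    : x ∈ᵥ Ts i
      shrinks : ∀ x' → adj T r' x' ≡ true → x' ∈ᵥ Ts j → count (Branch r' x') < count (Branch r x)

  -- r' is the first vertex of Ts j on a path from r, leaving r towards x, to w ∈ Ts i ∩ Ts j.
  -- A branch at r' into Ts j cannot contain r, since r reaches the neighbour p ∉ Ts j of r' outside
  -- Ts j; so it lies in the branch at r containing x, which contains r' while the smaller one does not.
  descend : ∀ {i j r} → r ∈ᵥ Ts i → Meets i j → Ts j r ≡ false → Descent i j r
  descend {i} {j} {r} r∈Ti (w , w∈Ti , w∈Tj) r∉Tj
    with last-exit (fromWalk (connected i r w r∈Ti w∈Ti)) (∈ᵥ⇒≢ {S = Ts j} w∈Tj r∉Tj)
  ... | x , r~x , x∈Ti , x⇝w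
    with first-entry (Ts j) (λ r∈Tj → ∈ᵥ⇒≢ {S = Ts j} r∈Tj r∉Tj refl) r~x x⇝w w∈Tj
  ... | p , r' , p~r' , r'∈Tj , r⇝p , x⇝r' =
    record { r' = r' ; r'∈Tj = r'∈Tj ; x = x ; r~x = r~x ; x∈Ti = x∈Ti ; shrinks = shrinks }
    where
    inside : ∀ x' → adj T r' x' ≡ true → x' ∈ᵥ Ts j → ∀ v → v ∈ᵥ Branch r' x' → v ∈ᵥ Branch r x
    inside x' r'~x' x'∈Tj v v∈branch with avoid-or-reach r (branch-sound v∈branch)
    ... | inj₁ x'⇝v = branch-complete
      (x⇝w ++ weaken (λ u∈Tj → ∈ᵥ⇒≢ {S = Ts j} u∈Tj r∉Tj) (fromWalk (connected j w x' w∈Tj x'∈Tj))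
           ++ x'⇝v)
    ... | inj₂ x'⇝r = ⊥-elim $ neighbours-separated acyclic x'≢p r'~x' (adj-sym T _ _ p~r')
      (x'⇝r ++ weaken (λ u∉Tj u≡r' → u∉Tj (subst (_∈ᵥ Ts j) (sym u≡r') r'∈Tj)) r⇝p)
      where
      x'≢p : x' ≢ p
      x'≢p refl = last∈ r⇝p x'∈Tj
    shrinks : ∀ x' → adj T r' x' ≡ true → x' ∈ᵥ Ts j → count (Branch r' x') < count (Branch r x)
    shrinks x' r'~x' x'∈Tj =
      count-mono-< (inside x' r'~x' x'∈Tj) r' (branch-excludes-root r' x') (branch-complete x⇝r')

  HasAnchor : (Fin n → Bool) → Set
  HasAnchor A = Σ (Fin n) λ i → Σ (Fin m) λ r → Anchor A i r

  anchor-below : ∀ (A : Fin n → Bool) N i r → A i ≡ true → r ∈ᵥ Ts i →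
                 (∀ x → adj T r x ≡ true → x ∈ᵥ Ts i → count (Branch r x) < N) → HasAnchor A
  anchor-below A N i r Ai r∈Ti below
    with any? (λ j → (A j ≟ᵇ true) ×-dec (meets? i j ×-dec (Ts j r ≟ᵇ false)))
  ... | no none = i , r , Ai , r∈Ti , r∈meeting
    where
    r∈meeting : ∀ j → A j ≡ true → Meets i j → r ∈ᵥ Ts j
    r∈meeting j Aj meets with Ts j r in r∈Tj
    ... | true = refl
    ... | false = contradiction (j , Aj , meets , r∈Tj) none
  ... | yes (j , Aj , meets , r∉Tj) = continue N (below x r~x x∈Ti)
    where
    open Descent (descend r∈Ti meets r∉Tj)
    continue : ∀ N → count (Branch r x) < N → HasAnchor A
    continue (suc N) |Brx|<1+N = anchor-below A N j r' Aj r'∈Tj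
      λ x' r'~x' x'∈Tj → <-≤-trans (shrinks x' r'~x' x'∈Tj) (s≤s⁻¹ |Brx|<1+N)

  anchor : ∀ (A : Fin n → Bool) {i r} → A i ≡ true → r ∈ᵥ Ts i → HasAnchor A
  anchor A {i} {r} Ai r∈Ti = anchor-below A (suc m) i r Ai r∈Ti (λ x _ _ → s≤s (count≤size (Branch r x)))

  EdgeIn : Fin m → Fin m → Fin n → Bool
  EdgeIn r x j = Ts j r ∧ Ts j x

  heavy-edge-at : ∀ {b r x} → adj T r x ≡ true → b ≤ count (EdgeIn r x) → HasHeavyEdge T Ts b
  heavy-edge-at {b} {r} {x} r~x b≤|rx| =
    let (g , g-injective , g∋rx) = select-distinct b (EdgeIn r x) b≤|rx|
    in r , x , r~x , g , g-injective , λ k → ∧-conicalˡ _ _ (g∋rx k) , ∧-conicalʳ _ _ (g∋rx k)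

  SharesEdgeAt : Fin m → Fin n → Fin n → Set
  SharesEdgeAt r j j' = ∃ λ x → (Ts j x ∧ adj T r x) ≡ true × EdgeIn r x j' ≡ true

  shares-edge-at? : ∀ r j j' → Dec (SharesEdgeAt r j j')
  shares-edge-at? r j j' = any? (λ x → ((Ts j x ∧ adj T r x) ≟ᵇ true) ×-dec (EdgeIn r x j' ≟ᵇ true))

  Conflict : Fin m → Fin n → Fin n → Bool
  Conflict r j j' = does (j' ≟ j) ∨ does (shares-edge-at? r j j')

  conflict-refl : ∀ r j → Conflict r j j ≡ true
  conflict-refl r j = cong (_∨ does (shares-edge-at? r j j)) (dec-true (j ≟ j) refl)

  -- Otherwise the paths from r to w inside the two subtrees leave r through distinct neighbours.
  meet-only-at : ∀ {r j j'} → r ∈ᵥ Ts j → r ∈ᵥ Ts j' → ¬ SharesEdgeAt r j j' →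
                 ∀ w → w ∈ᵥ Ts j → w ∈ᵥ Ts j' → w ≡ r
  meet-only-at {r} {j} {j'} r∈Tj r∈Tj' no-shared-edge w w∈Tj w∈Tj' with w ≟ r
  ... | yes w≡r = w≡r
  ... | no w≢r
    with last-exit (fromWalk (connected j r w r∈Tj w∈Tj)) w≢r
       | last-exit (fromWalk (connected j' r w r∈Tj' w∈Tj')) w≢r
  ... | x , r~x , x∈Tj , x⇝w | y , r~y , y∈Tj' , y⇝w with x ≟ y
  ... | yes refl = ⊥-elim (no-shared-edge (x , ∧-intro x∈Tj r~x , ∧-intro r∈Tj' y∈Tj'))
  ... | no x≢y = ⊥-elim (neighbours-separated acyclic x≢y r~x r~y (x⇝w ++ reverse y⇝w))

  -- Besides j itself, j conflicts only with sets containing one of its at most d edges at r,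
  -- each of which lies in fewer than b sets.
  conflicts-bound : ∀ {b d r j} → (∀ x → adj T r x ≡ true → count (EdgeIn r x) < b) →
                    degIn T (Ts j) r ≤ d → count (Conflict r j) ≤ 1 + d * pred b
  conflicts-bound {b} {d} {r} {j} light-edges deg≤d = begin
    count (Conflict r j)
      ≤⟨ count-∪ (λ j' → does (j' ≟ j)) (λ j' → does (shares-edge-at? r j j')) ⟩
    count (λ j' → does (j' ≟ j)) + count (λ j' → does (shares-edge-at? r j j'))
      ≤⟨ +-mono-≤ (count-singleton j)
                  (union-bound B (EdgeIn r) _ (λ j' → does-true⇒ (shares-edge-at? r j j'))) ⟩
    1 + ∑[ x < m ] (𝟙 (B x) * count (EdgeIn r x))
      ≤⟨ +-monoʳ-≤ 1 (sum-mono-≤ light) ⟩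
    1 + ∑[ x < m ] (𝟙 (B x) * pred b)
      ≡⟨ cong (1 +_) (sym (*-distribʳ-sum (pred b) (λ x → 𝟙 (B x)))) ⟩
    1 + (∑[ x < m ] 𝟙 (B x)) * pred b
      ≡⟨ cong (λ k → 1 + k * pred b) (sym (List-sum-allFin (λ x → 𝟙 (B x)))) ⟩
    1 + degIn T (Ts j) r * pred b
      ≤⟨ +-monoʳ-≤ 1 (*-monoˡ-≤ (pred b) deg≤d) ⟩
    1 + d * pred b ∎
    where
    open ≤-Reasoning
    B : Fin m → Bool
    B x = Ts j x ∧ adj T r x
    light : ∀ x → 𝟙 (B x) * count (EdgeIn r x) ≤ 𝟙 (B x) * pred b
    light x with B x in x∈Tj∧r~x
    ... | false = z≤n
    ... | true = *-monoʳ-≤ 1 (<⇒≤pred (light-edges x (∧-conicalʳ _ _ x∈Tj∧r~x)))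

  star-at : ∀ {b c d} r → 1 ≤ b → 1 ≤ d → (∀ j → MaxDegAtMost T (Ts j) d) →
            (∀ x → adj T r x ≡ true → count (EdgeIn r x) < b) →
            c * (d * b) ≤ count (λ j → Ts j r) → HasStar Ts c
  star-at {suc b} {c} {d} r _ 1≤d deg light-edges enough =
    r , h , independent⇒injective (Conflict r) (conflict-refl r) independent , h∋r , meet-exactly
    where
    1+d*b≤d*[1+b] : 1 + d * b ≤ d * suc b
    1+d*b≤d*[1+b] = ≤-trans (+-monoˡ-≤ (d * b) 1≤d) (≤-reflexive (sym (*-suc d b)))
    selection = select-independent c (*-mono-≤ 1≤d (s≤s z≤n))
                  (λ j → Ts j r) (Conflict r) (conflict-refl r)
                  (λ j r∈Tj → ≤-trans (conflicts-bound light-edges (deg j r r∈Tj)) 1+d*b≤d*[1+b]) enough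
    h = proj₁ selection
    h∋r = proj₁ (proj₂ selection)
    independent = proj₂ (proj₂ selection)
    no-shared-edge : ∀ {j j'} → Conflict r j j' ≡ false → ¬ SharesEdgeAt r j j'
    no-shared-edge {j} {j'} no-conflict =
      does-false⇒ (shares-edge-at? r j j') (∨-conicalʳ _ _ no-conflict)
    meet-exactly : ∀ k k' → k ≢ k' → ∀ w → w ∈ᵥ Ts (h k) → w ∈ᵥ Ts (h k') → w ≡ r
    meet-exactly k k' k≢k' w w∈Tk w∈Tk' with independent k k' k≢k'
    ... | inj₁ no-conflict = meet-only-at (h∋r k) (h∋r k') (no-shared-edge no-conflict) w w∈Tk w∈Tk'
    ... | inj₂ no-conflict = meet-only-at (h∋r k') (h∋r k) (no-shared-edge no-conflict) w w∈Tk' w∈Tk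

  DisjointIn : (Fin n → Bool) → ℕ → Set
  DisjointIn A a = Σ (Fin a → Fin n) λ f → Injective _≡_ _≡_ f × (∀ k → A (f k) ≡ true) ×
                     (∀ k k' → k ≢ k' → ∀ w → ¬ (w ∈ᵥ Ts (f k) × w ∈ᵥ Ts (f k')))

  extend-disjoint : ∀ {A i r a} → Anchor A i r →
                    DisjointIn (λ j → A j ∧ not (Ts j r)) a → DisjointIn A (suc a)
  extend-disjoint {A} {i} {r} {a} (Ai , r∈Ti , anchored) (f' , f'-injective , f'∈A∖r , f'-disjoint) =
    f , f-injective , f∈A , f-disjoint
    where
    f'∈A : ∀ k → A (f' k) ≡ true
    f'∈A k = ∧-conicalˡ _ _ (f'∈A∖r k)
    r∉f' : ∀ k → Ts (f' k) r ≡ false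
    r∉f' k = not-injective (∧-conicalʳ _ _ (f'∈A∖r k))
    Ti-misses : ∀ k → ¬ Meets i (f' k)
    Ti-misses k meets = ∈ᵥ⇒≢ {S = Ts (f' k)} (anchored (f' k) (f'∈A k) meets) (r∉f' k) refl
    i≢f' : ∀ k → i ≢ f' k
    i≢f' k i≡f'k = ∈ᵥ⇒≢ {S = Ts (f' k)} (subst (λ j → r ∈ᵥ Ts j) i≡f'k r∈Ti) (r∉f' k) refl
    f : Fin (suc a) → Fin n
    f zero = i
    f (suc k) = f' k
    f-injective : Injective _≡_ _≡_ f
    f-injective {zero} {zero} _ = refl
    f-injective {zero} {suc k} i≡f'k = contradiction i≡f'k (i≢f' k)
    f-injective {suc k} {zero} f'k≡i = contradiction (sym f'k≡i) (i≢f' k)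
    f-injective {suc k} {suc k'} f'k≡f'k' = cong suc (f'-injective f'k≡f'k')
    f∈A : ∀ k → A (f k) ≡ true
    f∈A zero = Ai
    f∈A (suc k) = f'∈A k
    f-disjoint : ∀ k k' → k ≢ k' → ∀ w → ¬ (w ∈ᵥ Ts (f k) × w ∈ᵥ Ts (f k'))
    f-disjoint zero zero 0≢0 _ _ = 0≢0 refl
    f-disjoint zero (suc k') _ w (w∈Ti , w∈Tk') = Ti-misses k' (w , w∈Ti , w∈Tk')
    f-disjoint (suc k) zero _ w (w∈Tk , w∈Ti) = Ti-misses k (w , w∈Ti , w∈Tk)
    f-disjoint (suc k) (suc k') k≢k' = f'-disjoint k k' (λ k≡k' → k≢k' (cong suc k≡k'))

  disjoint-or-heavy-edge-or-star :
    ∀ {b c d} → 1 ≤ b → 1 ≤ c → 1 ≤ d → (∀ i → ∃ λ v → v ∈ᵥ Ts i) → (∀ i → MaxDegAtMost T (Ts i) d) →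
    ∀ a (A : Fin n → Bool) → a * (c * (d * b)) ≤ count A →
    DisjointIn A a ⊎ (HasHeavyEdge T Ts b ⊎ HasStar Ts c)
  disjoint-or-heavy-edge-or-star _ _ _ _ _ zero A _ = inj₁ ((λ ()) , (λ { {()} }) , (λ ()) , (λ ()))
  disjoint-or-heavy-edge-or-star {b} {c} {d} 1≤b 1≤c 1≤d nonempty deg (suc a) A enough
    with count-nonempty A (≤-trans (*-mono-≤ 1≤c (*-mono-≤ 1≤d 1≤b)) (≤-trans (m≤m+n _ _) enough))
  ... | i₀ , Ai₀ with anchor A Ai₀ (proj₂ (nonempty i₀))
  ... | i , r , anchored with any? (λ x → (adj T r x ≟ᵇ true) ×-dec (b ≤? count (EdgeIn r x)))
  ... | yes (x , r~x , heavy) = inj₂ (inj₁ (heavy-edge-at r~x heavy))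
  ... | no no-heavy with c * (d * b) ≤? count (λ j → A j ∧ Ts j r)
  ... | yes many =
    inj₂ (inj₂ (star-at r 1≤b 1≤d deg light (≤-trans many (count-mono (λ j → ∧-conicalʳ (A j) _)))))
    where
    light : ∀ x → adj T r x ≡ true → count (EdgeIn r x) < b
    light x r~x = ≰⇒> (λ heavy → no-heavy (x , r~x , heavy))
  ... | no few = Sum.map₁ (extend-disjoint anchored)
    (disjoint-or-heavy-edge-or-star 1≤b 1≤c 1≤d nonempty deg a (λ j → A j ∧ not (Ts j r))
      (count-∖ A (λ j → Ts j r) enough (<⇒≤ (≰⇒> few))))

mainTheorem20 : (a b c d n m : ℕ) → 1 ≤ a → 1 ≤ b → 1 ≤ c → 1 ≤ d → a * b * c * d ≤ n →
                (T : Graph m) → IsTree T →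
                (Ts : Fin n → VSet m) → (∀ i → IsSubtree T (Ts i)) → (∀ i → MaxDegAtMost T (Ts i) d) →
                HasDisjoint Ts a ⊎ (HasHeavyEdge T Ts b ⊎ HasStar Ts c)
mainTheorem20 a b c d n m _ 1≤b 1≤c 1≤d abcd≤n T (_ , _ , acyclic) Ts subtree deg =
  Sum.map₁ forget-membership
    (disjoint-or-heavy-edge-or-star acyclic Ts (proj₂ ∘ subtree) 1≤b 1≤c 1≤d (proj₁ ∘ subtree) deg
      a (λ _ → true) (subst₂ _≤_ (reassociate a b c d) (sym count-full) abcd≤n))
  where
  reassociate : ∀ a b c d → a * b * c * d ≡ a * (c * (d * b))
  reassociate = solve-∀
  forget-membership : DisjointIn acyclic Ts (proj₂ ∘ subtree) (λ _ → true) a → HasDisjoint Ts a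
  forget-membership (f , f-injective , _ , f-disjoint) = f , f-injective , f-disjoint
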